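{- If a signed graph $(G,\sigma)$ has a $(k,d)$-coloring and $k'$ is a positive integer with $k'>k$, then $(G,\sigma)$ has a $(k',d)$-coloring.
   Context: Graphs are simple and finite. A signed graph $(G,\sigma)$ is a graph $G$ with a map $\sigma:E(G)\to\{\pm1\}$. For $x\in\mathbb{R}$ and $r>0$, $[x]_r\in[0,r)$ is the remainder of $x$ modulo $r$ and $|x|_r=\min\{[x]_r,[-x]_r\}$. For positive integers $k\ge 2d$, a $(k,d)$-coloring of $(G,\sigma)$ is a map $c:V(G)\to\mathbb{Z}_k$ such that $|c(v)-\sigma(e)c(w)|_k\ge d$ for every edge $e=vw$. -}

module Defs where

open import Level using (0ℓ)
open import Data.Nat as ℕ using (ℕ; suc; NonZero)
open import Data.Fin using (Fin; toℕ)
open import Data.Integer as ℤ using (ℤ; +_)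
open import Data.Integer.DivMod using (_%ℕ_)
open import Relation.Binary.PropositionalEquality using (_≡_)
open import Relation.Nullary using (¬_)
open import Data.Product using (Σ)

record SimpleGraph : Set₁ where
  field
    n       : ℕ
    Adj     : Fin n → Fin n → Set
    symAdj  : ∀ {u v} → Adj u v → Adj v u
    irrefl  : ∀ {u} → ¬ Adj u u
    -- at most one edge between u and v (edges are unordered pairs)
    adjProp : ∀ {u v} (p q : Adj u v) → p ≡ q

open SimpleGraph public

data Sign : Set where
  plus minus : Sign

signℤ : Sign → ℤ
signℤ plus  = + 1
signℤ minus = ℤ.- (+ 1)

record SignedGraph : Set₁ where
  field
    graph : SimpleGraph
    σ     : ∀ {u v} → Adj graph u v → Sign
    σ-sym : ∀ {u v} (e : Adj graph u v) → σ (symAdj graph e) ≡ σ e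

open SignedGraph public

[_]mod_ : ℤ → (r : ℕ) → .{{NonZero r}} → ℕ
[ x ]mod r = x %ℕ r

∣_∣mod_ : ℤ → (r : ℕ) → .{{NonZero r}} → ℕ
∣ x ∣mod r = ℕ._⊓_ ([ x ]mod r) ([ ℤ.- x ]mod r)

IsColoring : (S : SignedGraph) (k d : ℕ) .{{_ : NonZero k}} →
             (Fin (n (graph S)) → Fin k) → Set
IsColoring S k d c =
  ∀ {v w} (e : Adj (graph S) v w) →
    d ℕ.≤ ∣ (+ toℕ (c v)) ℤ.- (signℤ (σ S e) ℤ.* (+ toℕ (c w))) ∣mod k

HasColoring : (S : SignedGraph) (k d : ℕ) .{{_ : NonZero k}} → Set
HasColoring S k d = Σ (Fin (n (graph S)) → Fin k) (IsColoring S k d)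

-- It suffices to pass from k to k + 1. Embed ℤ_k into ℤ_(k+1) by a ↦ a for 2a < k and
-- a ↦ a + 1 otherwise. As |x|_k is the distance from x to the nearest multiple of k, it
-- suffices that for every q the new difference y = f(a) - σ f(b) is at least as far from
-- q(k+1) as x = a - σ b is from qk. But y - q(k+1) = (x - qk) + (δ - q) with
-- δ = (f(a) - a) - σ (f(b) - b), and since a, b < k a case analysis on q shows that the
-- two summands never have opposite signs.

module Submission where

open import Function using (_∘_)
open import Data.Empty using (⊥-elim)
open import Data.Product using (_×_; _,_; ∃-syntax)
import Data.Product as Product
open import Data.Sum using (_⊎_; inj₁; inj₂)
import Data.Sum as Sum
open import Relation.Nullary using (yes; no)
open import Relation.Binary.PropositionalEquality
  using (_≡_; refl; sym; trans; cong; subst; subst₂)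

open import Data.Nat as ℕ using (ℕ; zero; suc; NonZero; z≤n; s≤s; _≤′_; ≤′-refl; ≤′-step)
import Data.Nat.Properties as ℕ
open import Data.Fin using (Fin; toℕ; inject₁) renaming (suc to fsuc)
open import Data.Fin.Properties using (toℕ-inject₁; toℕ<n)
open import Data.Integer
  using (ℤ; +_; -[1+_]; 0ℤ; _+_; _-_; _*_; -_; ∣_∣; _⊖_; _≤_; _<_; +≤+; -≤+)
open import Data.Integer.Properties
  using ( pos-+; pos-*; neg-involutive; ∣-i∣≡∣i∣; neg-distrib-+; neg-distribˡ-*
        ; *-identityˡ; -1*i≡-i; m-n≡m⊖n; n⊖n≡0; ⊖-monoˡ-<
        ; ≤-trans; <-asym; neg-mono-≤; neg-mono-<; neg-≤-pos
        ; i≤j⇒0≤j-i; i≤j⇒i-j≤0; i-j≤i; i≤j+i)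
open import Data.Integer.DivMod using (_%ℕ_; _/ℕ_; a≡a%ℕn+[a/ℕn]*n; n%ℕd<d)
open import Data.Integer.Tactic.RingSolver using (solve-∀)

open import Defs

r≤∣r+tk∣ : ∀ r t k → r ℕ.≤ ∣ + r + + t * + k ∣
r≤∣r+tk∣ r t k rewrite sym (pos-* t k) | sym (pos-+ r (t ℕ.* k)) = ℕ.m≤m+n r (t ℕ.* k)

-[1+n]*k≡-[[1+n]*k] : ∀ n k → -[1+ n ] * + k ≡ - + (suc n ℕ.* k)
-[1+n]*k≡-[[1+n]*k] n k =
  trans (sym (neg-distribˡ-* (+ suc n) (+ k))) (cong -_ (sym (pos-* (suc n) k)))

r+tk<0 : ∀ {r k} t → r ℕ.< k → + r + -[1+ t ] * + k < 0ℤ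
r+tk<0 {r} {k} t r<k
  rewrite -[1+n]*k≡-[[1+n]*k] t k | m-n≡m⊖n r (suc t ℕ.* k) =
  subst (r ⊖ N <_) (n⊖n≡0 N) (⊖-monoˡ-< N (ℕ.<-≤-trans r<k (ℕ.m≤m+n k (t ℕ.* k))))
  where N = suc t ℕ.* k

r⊓r′≤∣z∣ : ∀ {k r r′ z} t t′ → r ℕ.< k → r′ ℕ.< k →
           z ≡ + r + t * + k → - z ≡ + r′ + t′ * + k → r ℕ.⊓ r′ ℕ.≤ ∣ z ∣
r⊓r′≤∣z∣ {k} {r} {r′} (+ t) _ _ _ refl _ = ℕ.≤-trans (ℕ.m⊓n≤m r r′) (r≤∣r+tk∣ r t k)
r⊓r′≤∣z∣ {k} {r} {r′} {z} -[1+ _ ] (+ t′) _ _ _ -z≡ =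
  ℕ.≤-trans (ℕ.m⊓n≤n r r′)
    (subst (r′ ℕ.≤_) (trans (cong ∣_∣ (sym -z≡)) (∣-i∣≡∣i∣ z)) (r≤∣r+tk∣ r′ t′ k))
-- t and t′ cannot both be negative, for then z and - z would both be negative.
r⊓r′≤∣z∣ {z = z} -[1+ t ] -[1+ t′ ] r<k r′<k refl -z≡ = ⊥-elim (<-asym z<0 0<z)
  where
  z<0 : z < 0ℤ
  z<0 = r+tk<0 t r<k
  0<z : 0ℤ < z
  0<z = subst (0ℤ <_) (neg-involutive z)
              (neg-mono-< (subst (_< 0ℤ) (sym -z≡) (r+tk<0 t′ r′<k)))

module _ {k : ℕ} .{{_ : NonZero k}} where

  private
    shift : ∀ x q → x - q * + k ≡ + (x %ℕ k) + (x /ℕ k - q) * + k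
    shift x q = trans (cong (_- q * + k) (a≡a%ℕn+[a/ℕn]*n x k))
                      (identity (+ (x %ℕ k)) (x /ℕ k) q (+ k))
      where
      identity : ∀ r Q q K → (r + Q * K) - q * K ≡ r + (Q - q) * K
      identity = solve-∀

    cancel : ∀ x → x - (x /ℕ k) * + k ≡ + (x %ℕ k)
    cancel x = trans (cong (_- (x /ℕ k) * + k) (a≡a%ℕn+[a/ℕn]*n x k))
                     (identity (+ (x %ℕ k)) (x /ℕ k) (+ k))
      where
      identity : ∀ r Q K → (r + Q * K) - Q * K ≡ r
      identity = solve-∀

    neg-sub : ∀ x q → - (x - q * + k) ≡ - x - (- q) * + k
    neg-sub x q = identity x q (+ k)
      where
      identity : ∀ x q K → - (x - q * K) ≡ - x - (- q) * K
      identity = solve-∀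

  ∣x∣mod≤∣x-qk∣ : ∀ x q → ∣ x ∣mod k ℕ.≤ ∣ x - q * + k ∣
  ∣x∣mod≤∣x-qk∣ x q =
    r⊓r′≤∣z∣ (x /ℕ k - q) ((- x) /ℕ k - (- q)) (n%ℕd<d x k) (n%ℕd<d (- x) k)
      (shift x q) (trans (neg-sub x q) (shift (- x) (- q)))

  ∣x∣mod-attained : ∀ x → ∃[ q ] ∣ x ∣mod k ≡ ∣ x - q * + k ∣
  ∣x∣mod-attained x with ℕ.⊓-sel ([ x ]mod k) ([ - x ]mod k)
  ... | inj₁ eq = x /ℕ k , trans eq (cong ∣_∣ (sym (cancel x)))
  ... | inj₂ eq =
    - Q , trans eq (trans (cong ∣_∣ (sym -[x+Qk]≡r)) (∣-i∣≡∣i∣ (x - (- Q) * + k)))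
    where
    Q = (- x) /ℕ k
    -[x+Qk]≡r : - (x - (- Q) * + k) ≡ + ((- x) %ℕ k)
    -[x+Qk]≡r = trans (neg-sub x (- Q))
      (trans (cong (λ q → - x - q * + k) (neg-involutive Q)) (cancel (- x)))

∣∣mod-mono : ∀ {k l} .{{_ : NonZero k}} .{{_ : NonZero l}} {x y} →
             (∀ q → ∣ x - q * + k ∣ ℕ.≤ ∣ y - q * + l ∣) → ∣ x ∣mod k ℕ.≤ ∣ y ∣mod l
∣∣mod-mono {k} {l} {x} {y} dist≤ with ∣x∣mod-attained y
... | q , eq =
  ℕ.≤-trans (∣x∣mod≤∣x-qk∣ x q) (subst (∣ x - q * + k ∣ ℕ.≤_) (sym eq) (dist≤ q))

0≤i⇒0≤j⇒∣i∣≤∣i+j∣ : ∀ {i j} → 0ℤ ≤ i → 0ℤ ≤ j → ∣ i ∣ ℕ.≤ ∣ i + j ∣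
0≤i⇒0≤j⇒∣i∣≤∣i+j∣ {+ m} {+ n} _ _ = ℕ.m≤m+n m n

∣i∣≤∣i+j∣ : ∀ {i j} → (0ℤ ≤ i × 0ℤ ≤ j) ⊎ (i ≤ 0ℤ × j ≤ 0ℤ) → ∣ i ∣ ℕ.≤ ∣ i + j ∣
∣i∣≤∣i+j∣ (inj₁ (0≤i , 0≤j)) = 0≤i⇒0≤j⇒∣i∣≤∣i+j∣ 0≤i 0≤j
∣i∣≤∣i+j∣ {i} {j} (inj₂ (i≤0 , j≤0)) =
  subst₂ ℕ._≤_ (∣-i∣≡∣i∣ i) ∣-i+-j∣≡∣i+j∣
    (0≤i⇒0≤j⇒∣i∣≤∣i+j∣ (neg-mono-≤ i≤0) (neg-mono-≤ j≤0))
  where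
  ∣-i+-j∣≡∣i+j∣ : ∣ - i + - j ∣ ≡ ∣ i + j ∣
  ∣-i+-j∣≡∣i+j∣ = trans (cong ∣_∣ (sym (neg-distrib-+ i j))) (∣-i∣≡∣i∣ (i + j))

OnSameSide : ℕ → ℤ → ℤ → ℤ → Set
OnSameSide k x δ q = (q * + k ≤ x × q ≤ δ) ⊎ (x ≤ q * + k × δ ≤ q)

∣x∣mod≤∣x+δ∣mod : ∀ {k} .{{_ : NonZero k}} x δ → (∀ q → OnSameSide k x δ q) →
                  ∣ x ∣mod k ℕ.≤ ∣ x + δ ∣mod suc k
∣x∣mod≤∣x+δ∣mod {k} x δ sameSide = ∣∣mod-mono {k} {suc k} {x} {x + δ} λ q →
  subst (∣ x - q * + k ∣ ℕ.≤_) (cong ∣_∣ (regroup x δ q (+ k)))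
    (∣i∣≤∣i+j∣ (signs q (sameSide q)))
  where
  regroup : ∀ x δ q K → (x - q * K) + (δ - q) ≡ (x + δ) - q * (+ 1 + K)
  regroup = solve-∀
  signs : ∀ q → OnSameSide k x δ q →
          (0ℤ ≤ x - q * + k × 0ℤ ≤ δ - q) ⊎ (x - q * + k ≤ 0ℤ × δ - q ≤ 0ℤ)
  signs q = Sum.map (Product.map i≤j⇒0≤j-i i≤j⇒0≤j-i) (Product.map i≤j⇒i-j≤0 i≤j⇒i-j≤0)

bump : ℕ → ℕ → ℕ
bump k a with 2 ℕ.* a ℕ.<? k
... | yes _ = 0
... | no _  = 1

bump≤1 : ∀ k a → bump k a ℕ.≤ 1
bump≤1 k a with 2 ℕ.* a ℕ.<? k
... | yes _ = z≤n
... | no _  = s≤s z≤n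

bump-mono : ∀ k {a b} → a ℕ.≤ b → bump k a ℕ.≤ bump k b
bump-mono k {a} {b} a≤b with 2 ℕ.* a ℕ.<? k | 2 ℕ.* b ℕ.<? k
... | yes _ | _     = z≤n
... | no _  | no _  = s≤s z≤n
... | no 2a≮k | yes 2b<k = ⊥-elim (2a≮k (ℕ.≤-<-trans (ℕ.*-monoʳ-≤ 2 a≤b) 2b<k))

bump+bump≥1 : ∀ k a b → k ℕ.≤ a ℕ.+ b → 1 ℕ.≤ bump k a ℕ.+ bump k b
bump+bump≥1 k a b k≤a+b with 2 ℕ.* a ℕ.<? k | 2 ℕ.* b ℕ.<? k
... | no _ | _    = s≤s z≤n
... | yes _ | no _ = s≤s z≤n
... | yes 2a<k | yes 2b<k = ⊥-elim (ℕ.<⇒≱ 2[a+b]<2k (ℕ.*-monoʳ-≤ 2 k≤a+b))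
  where
  2[a+b]<2k : 2 ℕ.* (a ℕ.+ b) ℕ.< 2 ℕ.* k
  2[a+b]<2k rewrite ℕ.*-distribˡ-+ 2 a b | ℕ.+-identityʳ k = ℕ.+-mono-< 2a<k 2b<k

bump+bump≤1 : ∀ k a b → a ℕ.+ b ℕ.< k → bump k a ℕ.+ bump k b ℕ.≤ 1
bump+bump≤1 k a b a+b<k with 2 ℕ.* a ℕ.<? k | 2 ℕ.* b ℕ.<? k
... | yes _ | yes _ = z≤n
... | yes _ | no _  = s≤s z≤n
... | no _  | yes _ = s≤s z≤n
... | no 2a≮k | no 2b≮k = ⊥-elim (ℕ.<⇒≱ (ℕ.*-monoʳ-< 2 a+b<k) 2k≤2[a+b])
  where
  2k≤2[a+b] : 2 ℕ.* k ℕ.≤ 2 ℕ.* (a ℕ.+ b)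
  2k≤2[a+b] rewrite ℕ.*-distribˡ-+ 2 a b | ℕ.+-identityʳ k =
    ℕ.+-mono-≤ (ℕ.≮⇒≥ 2a≮k) (ℕ.≮⇒≥ 2b≮k)

stretch : ∀ {k} → Fin k → Fin (suc k)
stretch {k} i with 2 ℕ.* toℕ i ℕ.<? k
... | yes _ = inject₁ i
... | no _  = fsuc i

toℕ-stretch : ∀ {k} (i : Fin k) → toℕ (stretch i) ≡ toℕ i ℕ.+ bump k (toℕ i)
toℕ-stretch {k} i with 2 ℕ.* toℕ i ℕ.<? k
... | yes _ = trans (toℕ-inject₁ i) (sym (ℕ.+-identityʳ (toℕ i)))
... | no _  = ℕ.+-comm 1 (toℕ i)

+a≤+[1+n]*+k : ∀ {a k} n → a ℕ.< k → + a ≤ + suc n * + k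
+a≤+[1+n]*+k {a} {k} n a<k =
  subst (+ a ≤_) (pos-* (suc n) k) (+≤+ (ℕ.≤-trans (ℕ.<⇒≤ a<k) (ℕ.m≤m+n k (n ℕ.* k))))

-[1+n]*+k≤-+a : ∀ {a k} n → a ℕ.< k → -[1+ n ] * + k ≤ - + a
-[1+n]*+k≤-+a {a} {k} n a<k =
  subst (_≤ - + a) (neg-distribˡ-* (+ suc n) (+ k)) (neg-mono-≤ (+a≤+[1+n]*+k n a<k))

+bump≤+[1+n] : ∀ k a n → + bump k a ≤ + suc n
+bump≤+[1+n] k a n = +≤+ (ℕ.≤-trans (bump≤1 k a) (s≤s z≤n))

sameSide-plus : ∀ {k a b} → a ℕ.< k → b ℕ.< k →
                ∀ q → OnSameSide k (+ a - + b) (+ bump k a - + bump k b) q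
sameSide-plus {k} {a} {b} _ _ (+ zero) with ℕ.≤-total a b
... | inj₁ a≤b = inj₂ (i≤j⇒i-j≤0 (+≤+ a≤b) , i≤j⇒i-j≤0 (+≤+ (bump-mono k a≤b)))
... | inj₂ b≤a = inj₁ (i≤j⇒0≤j-i (+≤+ b≤a) , i≤j⇒0≤j-i (+≤+ (bump-mono k b≤a)))
sameSide-plus {k} {a} {b} a<k _ (+ suc n) = inj₂
  ( ≤-trans (i-j≤i (+ a) (+ b)) (+a≤+[1+n]*+k n a<k)
  , ≤-trans (i-j≤i (+ bump k a) (+ bump k b)) (+bump≤+[1+n] k a n) )
sameSide-plus {k} {a} {b} _ b<k -[1+ n ] = inj₁
  ( ≤-trans (-[1+n]*+k≤-+a n b<k) (i≤j+i (- + b) (+ a))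
  , ≤-trans (neg-mono-≤ (+bump≤+[1+n] k b n)) (i≤j+i (- + bump k b) (+ bump k a)) )

sameSide-minus : ∀ {k a b} → a ℕ.< k → b ℕ.< k →
                 ∀ q → OnSameSide k (+ (a ℕ.+ b)) (+ (bump k a ℕ.+ bump k b)) q
sameSide-minus _ _ (+ zero) = inj₁ (+≤+ z≤n , +≤+ z≤n)
sameSide-minus {k} {a} {b} _ _ (+ 1) with k ℕ.≤? a ℕ.+ b
... | yes k≤a+b = inj₁ (subst (_≤ + (a ℕ.+ b)) (sym (*-identityˡ (+ k))) (+≤+ k≤a+b)
                       , +≤+ (bump+bump≥1 k a b k≤a+b))
... | no k≰a+b  = inj₂ (subst (+ (a ℕ.+ b) ≤_) (sym (*-identityˡ (+ k))) (+≤+ (ℕ.<⇒≤ a+b<k))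
                       , +≤+ (bump+bump≤1 k a b a+b<k))
  where a+b<k = ℕ.≰⇒> k≰a+b
sameSide-minus {k} {a} {b} a<k b<k (+ suc (suc n)) = inj₂
  ( subst (+ (a ℕ.+ b) ≤_) (pos-* (suc (suc n)) k)
      (+≤+ (ℕ.+-mono-≤ (ℕ.<⇒≤ a<k) (ℕ.≤-trans (ℕ.<⇒≤ b<k) (ℕ.m≤m+n k (n ℕ.* k)))))
  , +≤+ (ℕ.+-mono-≤ (bump≤1 k a) (ℕ.≤-trans (bump≤1 k b) (s≤s z≤n))) )
sameSide-minus {k} _ _ -[1+ n ] = inj₁
  (subst (_≤ _) (sym (-[1+n]*k≡-[[1+n]*k] n k)) neg-≤-pos , -≤+)

∣∣mod-stretch : ∀ {k} .{{_ : NonZero k}} s {a b} → a ℕ.< k → b ℕ.< k →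
                ∣ + a - signℤ s * + b ∣mod k ℕ.≤
                ∣ + (a ℕ.+ bump k a) - signℤ s * + (b ℕ.+ bump k b) ∣mod suc k
∣∣mod-stretch {k} s {a} {b} a<k b<k =
  subst (λ y → ∣ + a - signℤ s * + b ∣mod k ℕ.≤ ∣ y ∣mod suc k) (sym split)
    (∣x∣mod≤∣x+δ∣mod (+ a - signℤ s * + b) (+ bump k a - signℤ s * + bump k b) (sameSide s))
  where
  regroup : ∀ a α b β s → (a + α) - s * (b + β) ≡ (a - s * b) + (α - s * β)
  regroup = solve-∀
  split : + (a ℕ.+ bump k a) - signℤ s * + (b ℕ.+ bump k b) ≡
          (+ a - signℤ s * + b) + (+ bump k a - signℤ s * + bump k b)
  split rewrite pos-+ a (bump k a) | pos-+ b (bump k b) =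
    regroup (+ a) (+ bump k a) (+ b) (+ bump k b) (signℤ s)
  sub-plus : ∀ i j → i - signℤ plus * j ≡ i - j
  sub-plus i j = cong (λ w → i - w) (*-identityˡ j)
  sub-minus : ∀ m n → + m - signℤ minus * + n ≡ + (m ℕ.+ n)
  sub-minus m n = trans (cong (λ w → + m - w) (-1*i≡-i (+ n)))
                        (trans (cong (λ w → + m + w) (neg-involutive (+ n))) (sym (pos-+ m n)))
  sameSide : ∀ s q → OnSameSide k (+ a - signℤ s * + b) (+ bump k a - signℤ s * + bump k b) q
  sameSide plus
    rewrite sub-plus (+ a) (+ b) | sub-plus (+ bump k a) (+ bump k b) = sameSide-plus a<k b<k
  sameSide minus
    rewrite sub-minus a b | sub-minus (bump k a) (bump k b) = sameSide-minus a<k b<k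

HasColoring-suc : ∀ {S d k} .{{_ : NonZero k}} → HasColoring S k d → HasColoring S (suc k) d
HasColoring-suc {S} {d} {k} (c , c-ok) = stretch ∘ c , stretch∘c-ok
  where
  stretch∘c-ok : IsColoring S (suc k) d (stretch ∘ c)
  stretch∘c-ok {v} {w} e rewrite toℕ-stretch (c v) | toℕ-stretch (c w) =
    ℕ.≤-trans (c-ok e) (∣∣mod-stretch (σ S e) (toℕ<n (c v)) (toℕ<n (c w)))

HasColoring-≤′ : ∀ {S d k m} .{{_ : NonZero k}} → k ≤′ m →
                 HasColoring S k d → HasColoring S (suc m) d
HasColoring-≤′ {S} {d} ≤′-refl = HasColoring-suc {S} {d}
HasColoring-≤′ {S} {d} (≤′-step k≤′m) = HasColoring-suc {S} {d} ∘ HasColoring-≤′ {S} {d} k≤′m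

lemma11 : (S : SignedGraph) (k d k′ : ℕ) .{{_ : NonZero k}} .{{_ : NonZero d}} .{{_ : NonZero k′}} →
          2 ℕ.* d ℕ.≤ k → k ℕ.< k′ → HasColoring S k d → HasColoring S k′ d
-- Stretching never shrinks circular distances.
lemma11 S k d (suc m) _ k<1+m = HasColoring-≤′ {S} {d} (ℕ.≤⇒≤′ (ℕ.s≤s⁻¹ k<1+m))
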